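{- Let $G=(A\cup B,E)$ with $|A|=|B|=n$, where each agent has a strict partial order over her neighbors. Let $M^\star$ be a popular assignment in $G$ and let $\vec\alpha$ be a dual certificate of $M^\star$. Then for every $b\in B$, $|\alpha_b|\ge \ell(b)$, where $\ell(b)$ is the level of $b$ when Algorithm 1 (described in the context) terminates on $G$ (for any choice of the maximum matchings computed by the algorithm).
   Context: For a perfect matching $M$ and $(a,b)\in E$: $\mathsf{wt}_M(a,b)=1$ if $b\succ_a M(a)$, $-1$ if $M(a)\succ_a b$, $0$ otherwise. A dual certificate for a popular assignment $M$ is an optimal solution $\vec\alpha$ of the LP $\min\sum_{u\in A\cup B}y_u$ s.t. $y_a+y_b\ge\mathsf{wt}_M(a,b)$ for all $(a,b)\in E$, with $\alpha_a\in\{0,1,\dots,n-1\}$ for $a\in A$, $\alpha_b\in\{0,-1,\dots,-(n-1)\}$ for $b\in B$, and $\sum_u\alpha_u=0$. For a level function $\ell:B\to\mathbb{N}$ and $a\in A$, $\ell^*(a)=\max_{b\in\mathsf{Nbr}(a)}\ell(b)$; $G_\ell=(A\cup B,E_\ell)$ contains $(a,b)\in E$ iff (i) $\ell(b)=\ell^*(a)$ and no neighbor $b'$ of $a$ with $\ell(b')=\ell^*(a)$ satisfies $b'\succ_a b$; or (ii) $\ell(b)=\ell^*(a)-1$, $b\succ_a b'$ for all neighbors $b'$ of $a$ with $\ell(b')=\ell^*(a)$, and no neighbor $b''$ of $a$ with $\ell(b'')=\ell^*(a)-1$ satisfies $b''\succ_a b$. Algorithm 1: set $\ell\equiv 0$;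 while $\ell(b)<n$ for all $b$: compute a maximum matching $M$ in $G_\ell$; if $M$ is perfect return $M$; else increase $\ell(b)$ by 1 for each $b$ unmatched in $M$. If the loop ends, report no popular assignment. Popularity: $\Delta(M,N)$ is the number of agents preferring $M$ to $N$ minus the number preferring $N$ to $M$ (agent $a$ prefers $M$ if matched in $M$ and either unmatched in $N$ or $M(a)\succ_aN(a)$); a popular assignment is a perfect matching $M$ with $\Delta(M,N)\ge0$ for all perfect matchings $N$. -}

module Defs where

open import Data.Bool using (Bool; true; false; T; if_then_else_)
open import Data.Nat as ℕ using (ℕ; zero; suc; _+_; _⊔_)
open import Data.Fin using (Fin; zero; suc)
open import Data.Integer as ℤ using (ℤ; +_; _⊖_)
open import Data.Rational as ℚ using (ℚ; 0ℚ; 1ℚ)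
open import Data.Maybe using (Maybe; just; nothing; is-just)
open import Data.Product using (Σ; ∃; _×_; _,_)
open import Data.Sum using (_⊎_)
open import Relation.Nullary using (¬_)
open import Relation.Binary.PropositionalEquality using (_≡_)
open import Function.Definitions using (Injective)

sumℕ : ∀ {n} → (Fin n → ℕ) → ℕ
sumℕ {zero}  f = 0
sumℕ {suc n} f = f zero + sumℕ (λ i → f (suc i))

maxℕ : ∀ {n} → (Fin n → ℕ) → ℕ
maxℕ {zero}  f = 0
maxℕ {suc n} f = f zero ⊔ maxℕ (λ i → f (suc i))

sumℤ : ∀ {n} → (Fin n → ℤ) → ℤ
sumℤ {zero}  f = + 0
sumℤ {suc n} f = f zero ℤ.+ sumℤ (λ i → f (suc i))

sumℚ : ∀ {n} → (Fin n → ℚ) → ℚ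
sumℚ {zero}  f = 0ℚ
sumℚ {suc n} f = f zero ℚ.+ sumℚ (λ i → f (suc i))

count : ∀ {n} → (Fin n → Bool) → ℕ
count f = sumℕ (λ i → if f i then 1 else 0)

toℚ : ℤ → ℚ
toℚ z = z ℚ./ 1

-- An instance: agents A = Fin n, items B = Fin n (so |A| = |B| = n),
-- edge set E, and for each agent a a strict partial order ≻_a over her
-- neighbours:  pref a b b' = true  iff  b ≻_a b'.

record Instance (n : ℕ) : Set where
  field
    E      : Fin n → Fin n → Bool
    pref   : Fin n → Fin n → Fin n → Bool
    irrefl : ∀ a b → pref a b b ≡ false
    trans  : ∀ a b c d → T (pref a b c) → T (pref a c d) → T (pref a b d)
    onNbrs : ∀ a b b' → T (pref a b b') → T (E a b) × T (E a b')

module _ {n : ℕ} (I : Instance n) where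
  open Instance I

  record PerfectMatching : Set where
    field
      mate    : Fin n → Fin n
      inj     : Injective _≡_ _≡_ mate
      inEdges : ∀ a → T (E a (mate a))

  open PerfectMatching

  Δ : PerfectMatching → PerfectMatching → ℤ
  Δ M N = count (λ a → pref a (mate M a) (mate N a))
        ⊖ count (λ a → pref a (mate N a) (mate M a))

  Popular : PerfectMatching → Set
  Popular M = ∀ (N : PerfectMatching) → + 0 ℤ.≤ Δ M N

  wt : PerfectMatching → Fin n → Fin n → ℤ
  wt M a b = if pref a b (mate M a) then + 1
             else (if pref a (mate M a) b then ℤ.- (+ 1) else + 0)

  wtℚ : PerfectMatching → Fin n → Fin n → ℚ
  wtℚ M a b = toℚ (wt M a b)

  LPFeasible : PerfectMatching → (Fin n → ℚ) → (Fin n → ℚ) → Set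
  LPFeasible M yA yB = ∀ a b → T (E a b) → wtℚ M a b ℚ.≤ yA a ℚ.+ yB b

  LPValue : (Fin n → ℚ) → (Fin n → ℚ) → ℚ
  LPValue yA yB = sumℚ yA ℚ.+ sumℚ yB

  record DualCertificate (M : PerfectMatching) (αA αB : Fin n → ℤ) : Set where
    field
      feasible : LPFeasible M (λ a → toℚ (αA a)) (λ b → toℚ (αB b))
      optimal  : ∀ yA yB → LPFeasible M yA yB →
                 LPValue (λ a → toℚ (αA a)) (λ b → toℚ (αB b)) ℚ.≤ LPValue yA yB
      rangeA   : ∀ a → + 0 ℤ.≤ αA a × αA a ℤ.< + n
      rangeB   : ∀ b → ℤ.- (+ n) ℤ.< αB b × αB b ℤ.≤ + 0
      sumZero  : sumℤ αA ℤ.+ sumℤ αB ≡ + 0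

  Level : Set
  Level = Fin n → ℕ

  -- ℓ*(a) = max over neighbours b of a of ℓ(b)  (0 if a has no neighbour)
  ℓ* : Level → Fin n → ℕ
  ℓ* ℓ a = maxℕ (λ b → if E a b then ℓ b else 0)

  Eℓ : Level → Fin n → Fin n → Set
  Eℓ ℓ a b = T (E a b) ×
    ( ( ℓ b ≡ ℓ* ℓ a
      × ¬ (∃ λ b' → T (E a b') × ℓ b' ≡ ℓ* ℓ a × T (pref a b' b)))
    ⊎ ( suc (ℓ b) ≡ ℓ* ℓ a
      × (∀ b' → T (E a b') → ℓ b' ≡ ℓ* ℓ a → T (pref a b b'))
      × ¬ (∃ λ b'' → T (E a b'') × suc (ℓ b'') ≡ ℓ* ℓ a × T (pref a b'' b))))

  record Matching (ℓ : Level) : Set where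
    field
      mate    : Fin n → Maybe (Fin n)
      inj     : ∀ a a' b → mate a ≡ just b → mate a' ≡ just b → a ≡ a'
      inEdges : ∀ a b → mate a ≡ just b → Eℓ ℓ a b

  size : ∀ {ℓ} → Matching ℓ → ℕ
  size M = count (λ a → is-just (Matching.mate M a))

  IsMaximum : ∀ {ℓ} → Matching ℓ → Set
  IsMaximum {ℓ} M = ∀ (N : Matching ℓ) → size N ℕ.≤ size M

  IsPerfect : ∀ {ℓ} → Matching ℓ → Set
  IsPerfect M = ∀ a → ∃ λ b → Matching.mate M a ≡ just b

  UnmatchedB : ∀ {ℓ} → Matching ℓ → Fin n → Set
  UnmatchedB M b = ¬ (∃ λ a → Matching.mate M a ≡ just b)

  NextLevel : ∀ {ℓ} → Matching ℓ → Level → Set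
  NextLevel {ℓ} M ℓ' = ∀ b → (UnmatchedB M b → ℓ' b ≡ suc (ℓ b))
                           × (¬ UnmatchedB M b → ℓ' b ≡ ℓ b)

  data Reachable : Level → Set where
    start : Reachable (λ _ → 0)
    step  : ∀ {ℓ ℓ'} → Reachable ℓ → (∀ b → ℓ b ℕ.< n) →
            (M : Matching ℓ) → IsMaximum M → ¬ IsPerfect M →
            NextLevel M ℓ' → Reachable ℓ'

  -- the algorithm stops at ℓ: either the loop condition fails, or the
  -- maximum matching computed in G_ℓ is perfect (and is returned)
  Terminal : Level → Set
  Terminal ℓ = (∃ λ b → n ℕ.≤ ℓ b)
             ⊎ ((∀ b → ℓ b ℕ.< n) × Σ (Matching ℓ) (λ M → IsMaximum M × IsPerfect M))

-- Write d(b) = |α_b|. Feasibility on the edges of M⋆ together with Σα = 0 forces complementary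
-- slackness α_a = d(M⋆(a)), after which feasibility on an edge (a,b) reads wt(a,b) + d(b) ≤ d(M⋆(a)):
-- items a prefers to M⋆(a) are strictly shallower than M⋆(a), items not worse than M⋆(a) are not
-- deeper, and every neighbour is at most one level deeper. We show that ℓ ≤ d is invariant under
-- Algorithm 1. Call b tight if ℓ(b) = d(b). If M⋆(a) is tight, these inequalities force ℓ*(a) to be
-- d(M⋆(a)) or d(M⋆(a)) + 1, put (a, M⋆(a)) into G_ℓ, and make every G_ℓ-neighbour of a tight. So a
-- matching of G_ℓ missing a tight item is not maximum: matching the agents M⋆⁻¹(tight) along M⋆ and
-- keeping the old edges into non-tight items gives a larger one. Hence only non-tight items are raised.

module Submission where

open import Defs
open import Data.Nat using (ℕ; _≤_)
open import Data.Fin using (Fin)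
open import Data.Integer using (ℤ; ∣_∣)

open import Data.Bool.Base using (Bool; true; false; T; not; _∧_; if_then_else_)
open import Data.Bool.Properties using (∧-identityʳ; T-≡)
open import Data.Empty using (⊥-elim)
open import Data.Fin.Base using (zero; suc; punchOut)
open import Data.Fin.Permutation using (Permutation; permutation; _⟨$⟩ʳ_)
open import Data.Fin.Properties using (_≟_; any?; 0≢1+n; injective⇒≤; punchOut-injective; suc-injective)
open import Data.Integer.Base using (0ℤ)
open import Data.Maybe.Base using (Maybe; just; nothing; maybe′; is-just)
open import Data.Maybe.Properties using (just-injective; ≡-dec)
open import Data.Nat.Base using (zero; suc; _+_; _<_; _≡ᵇ_; z≤n; s≤s; s≤s⁻¹)
open import Data.Product using (∃; _×_; _,_; proj₁; proj₂)
open import Data.Sum using (_⊎_; inj₁; inj₂)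
open import Function.Base using (_∘_)
open import Function.Definitions using (Injective)
open import Function.Bundles using (Injection; Equivalence)
open import Function.Properties.Inverse using (Inverse⇒Injection)
open import Relation.Binary.PropositionalEquality
open import Relation.Nullary using (¬_; yes; no; does; contradiction)
open import Relation.Nullary.Decidable using (dec-false)

import Algebra.Properties.CommutativeMonoid.Sum as CommutativeMonoidSum
import Data.Integer as ℤ
import Data.Integer.Properties as ℤ
import Data.Nat.Properties as ℕ
import Algebra.Properties.AbelianGroup ℤ.+-0-abelianGroup as ℤGroup
import Data.Rational as ℚ
import Data.Rational.Properties as ℚ
import Data.Rational.Unnormalised as ℚᵘ
import Data.Rational.Unnormalised.Properties as ℚᵘ

-- toℚ w is definitionally fromℚᵘ (mkℚᵘ w 0), which is what lets toℚᵘ-fromℚᵘ apply.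
toℚ-+-cancel-≤ : ∀ w x y → toℚ w ℚ.≤ toℚ x ℚ.+ toℚ y → w ℤ.≤ x ℤ.+ y
toℚ-+-cancel-≤ w x y h with lifted
  where
  open ℚᵘ.≤-Reasoning
  lifted : ℚᵘ.mkℚᵘ w 0 ℚᵘ.≤ ℚᵘ.mkℚᵘ x 0 ℚᵘ.+ ℚᵘ.mkℚᵘ y 0
  lifted = begin
    ℚᵘ.mkℚᵘ w 0                           ≃⟨ ℚᵘ.≃-sym (ℚ.toℚᵘ-fromℚᵘ _) ⟩
    ℚ.toℚᵘ (toℚ w)                        ≤⟨ ℚ.toℚᵘ-mono-≤ h ⟩
    ℚ.toℚᵘ (toℚ x ℚ.+ toℚ y)              ≃⟨ ℚ.toℚᵘ-homo-+ (toℚ x) (toℚ y) ⟩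
    ℚ.toℚᵘ (toℚ x) ℚᵘ.+ ℚ.toℚᵘ (toℚ y)    ≃⟨ ℚᵘ.+-cong (ℚ.toℚᵘ-fromℚᵘ (ℚᵘ.mkℚᵘ x 0)) (ℚ.toℚᵘ-fromℚᵘ (ℚᵘ.mkℚᵘ y 0)) ⟩
    ℚᵘ.mkℚᵘ x 0 ℚᵘ.+ ℚᵘ.mkℚᵘ y 0          ∎
... | ℚᵘ.*≤* w≤x+y
  rewrite ℤ.*-identityʳ w | ℤ.*-identityʳ x | ℤ.*-identityʳ y | ℤ.*-identityʳ (x ℤ.+ y) = w≤x+y

module ℕΣ = CommutativeMonoidSum ℕ.+-0-commutativeMonoid
module ℤΣ = CommutativeMonoidSum ℤ.+-0-commutativeMonoid

sumℕ≡sum : ∀ {m} (f : Fin m → ℕ) → sumℕ f ≡ ℕΣ.sum f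
sumℕ≡sum {zero}  f = refl
sumℕ≡sum {suc m} f = cong (f zero +_) (sumℕ≡sum (f ∘ suc))

sumℤ≡sum : ∀ {m} (f : Fin m → ℤ) → sumℤ f ≡ ℤΣ.sum f
sumℤ≡sum {zero}  f = refl
sumℤ≡sum {suc m} f = cong (λ s → f zero ℤ.+ s) (sumℤ≡sum (f ∘ suc))

sumℤ-distrib-+ : ∀ {m} (f g : Fin m → ℤ) → sumℤ (λ i → f i ℤ.+ g i) ≡ sumℤ f ℤ.+ sumℤ g
sumℤ-distrib-+ f g rewrite sumℤ≡sum (λ i → f i ℤ.+ g i) | sumℤ≡sum f | sumℤ≡sum g =
  ℤΣ.∑-distrib-+ f g

sumℤ-permute : ∀ {m} (f : Fin m → ℤ) (π : Permutation m m) → sumℤ f ≡ sumℤ (f ∘ (π ⟨$⟩ʳ_))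
sumℤ-permute f π rewrite sumℤ≡sum f | sumℤ≡sum (f ∘ (π ⟨$⟩ʳ_)) = ℤΣ.sum-permute f π

sumℤ-nonneg : ∀ {m} (f : Fin m → ℤ) → (∀ i → 0ℤ ℤ.≤ f i) → 0ℤ ℤ.≤ sumℤ f
sumℤ-nonneg {zero}  f f≥0 = ℤ.≤-refl
sumℤ-nonneg {suc m} f f≥0 = ℤ.+-mono-≤ (f≥0 zero) (sumℤ-nonneg (f ∘ suc) (f≥0 ∘ suc))

nonneg-+≡0⇒≡0 : ∀ {x y} → 0ℤ ℤ.≤ x → 0ℤ ℤ.≤ y → x ℤ.+ y ≡ 0ℤ → x ≡ 0ℤ × y ≡ 0ℤ
nonneg-+≡0⇒≡0 {ℤ.+ x} {ℤ.+ y} _ _ x+y≡0 =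
  cong ℤ.+_ (ℕ.m+n≡0⇒m≡0 x (ℤ.+-injective x+y≡0)) , cong ℤ.+_ (ℕ.m+n≡0⇒n≡0 x (ℤ.+-injective x+y≡0))

nonneg-sumℤ≡0⇒≡0 : ∀ {m} (f : Fin m → ℤ) → (∀ i → 0ℤ ℤ.≤ f i) → sumℤ f ≡ 0ℤ → ∀ i → f i ≡ 0ℤ
nonneg-sumℤ≡0⇒≡0 {suc m} f f≥0 Σf≡0 i with nonneg-+≡0⇒≡0 (f≥0 zero) (sumℤ-nonneg (f ∘ suc) (f≥0 ∘ suc)) Σf≡0
nonneg-sumℤ≡0⇒≡0 {suc m} f f≥0 Σf≡0 zero    | f₀≡0 , _    = f₀≡0
nonneg-sumℤ≡0⇒≡0 {suc m} f f≥0 Σf≡0 (suc i) | _    , Σf⁺≡0 = nonneg-sumℤ≡0⇒≡0 (f ∘ suc) (f≥0 ∘ suc) Σf⁺≡0 i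

𝟙 : Bool → ℕ
𝟙 b = if b then 1 else 0

count-cong : ∀ {m} {f g : Fin m → Bool} → (∀ i → f i ≡ g i) → count f ≡ count g
count-cong {f = f} {g} f≗g rewrite sumℕ≡sum (𝟙 ∘ f) | sumℕ≡sum (𝟙 ∘ g) =
  ℕΣ.sum-cong-≗ (cong 𝟙 ∘ f≗g)

count-split : ∀ {m} {f g h : Fin m → Bool} → (∀ i → 𝟙 (f i) ≡ 𝟙 (g i) + 𝟙 (h i)) →
              count f ≡ count g + count h
count-split {f = f} {g} {h} f≗g+h
  rewrite sumℕ≡sum (𝟙 ∘ f) | sumℕ≡sum (𝟙 ∘ g) | sumℕ≡sum (𝟙 ∘ h) =
  trans (ℕΣ.sum-cong-≗ f≗g+h) (ℕΣ.∑-distrib-+ (𝟙 ∘ g) (𝟙 ∘ h))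

count-permute : ∀ {m} (f : Fin m → Bool) (π : Permutation m m) → count f ≡ count (f ∘ (π ⟨$⟩ʳ_))
count-permute f π rewrite sumℕ≡sum (𝟙 ∘ f) | sumℕ≡sum (𝟙 ∘ f ∘ (π ⟨$⟩ʳ_)) =
  ℕΣ.sum-permute (𝟙 ∘ f) π

_─_ : ∀ {m} → (Fin m → Bool) → Fin m → Fin m → Bool
(Q ─ c) x = Q x ∧ not (does (x ≟ c))

─-≢ : ∀ {m} (Q : Fin m → Bool) {c x} → ¬ x ≡ c → (Q ─ c) x ≡ Q x
─-≢ Q {c} {x} x≢c rewrite dec-false (x ≟ c) x≢c = ∧-identityʳ (Q x)

count-remove : ∀ {m} (Q : Fin m → Bool) c → T (Q c) → count Q ≡ suc (count (Q ─ c))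
count-remove Q zero Qc rewrite Equivalence.to T-≡ Qc =
  cong suc (count-cong (λ i → sym (∧-identityʳ (Q (suc i)))))
count-remove Q (suc c) Qc rewrite count-remove (Q ∘ suc) c Qc | ∧-identityʳ (Q zero) =
  ℕ.+-suc (𝟙 (Q zero)) _

PartialInjective : ∀ {m k} → (Fin m → Maybe (Fin k)) → Set
PartialInjective g = ∀ a a' c → g a ≡ just c → g a' ≡ just c → a ≡ a'

PartialInjective-∘suc : ∀ {m k} {g : Fin (suc m) → Maybe (Fin k)} →
                        PartialInjective g → PartialInjective (g ∘ suc)
PartialInjective-∘suc g-inj a a' c p q = suc-injective (g-inj (suc a) (suc a') c p q)

count-preimage-≤ : ∀ {m k} (g : Fin m → Maybe (Fin k)) (Q : Fin k → Bool) →
                   PartialInjective g → count (maybe′ Q false ∘ g) ≤ count Q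
count-preimage-≤ {zero}  g Q g-inj = z≤n
count-preimage-≤ {suc m} g Q g-inj with g zero in g₀≡c
... | nothing = count-preimage-≤ (g ∘ suc) Q (PartialInjective-∘suc g-inj)
... | just c with Q c in Qc
...   | false = count-preimage-≤ (g ∘ suc) Q (PartialInjective-∘suc g-inj)
...   | true = begin
  suc (count (maybe′ Q false ∘ g ∘ suc))        ≡⟨ cong suc (count-cong avoids-c) ⟩
  suc (count (maybe′ (Q ─ c) false ∘ g ∘ suc))  ≤⟨ s≤s (count-preimage-≤ (g ∘ suc) (Q ─ c) (PartialInjective-∘suc g-inj)) ⟩
  suc (count (Q ─ c))                           ≡⟨ count-remove Q c (Equivalence.from T-≡ Qc) ⟨
  count Q                                       ∎
  where
  open ℕ.≤-Reasoning
  avoids-c : ∀ a → maybe′ Q false (g (suc a)) ≡ maybe′ (Q ─ c) false (g (suc a))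
  avoids-c a with g (suc a) in g⁺≡d
  ... | nothing = refl
  ... | just d = sym (─-≢ Q (λ { refl → 0≢1+n (g-inj zero (suc a) d g₀≡c g⁺≡d) }))

≤-maxℕ : ∀ {m} (f : Fin m → ℕ) i → f i ≤ maxℕ f
≤-maxℕ f zero    = ℕ.m≤m⊔n _ _
≤-maxℕ f (suc i) = ℕ.m≤n⇒m≤o⊔n (f zero) (≤-maxℕ (f ∘ suc) i)

maxℕ-lub : ∀ {m} (f : Fin m → ℕ) {c} → (∀ i → f i ≤ c) → maxℕ f ≤ c
maxℕ-lub {zero}  f f≤c = z≤n
maxℕ-lub {suc m} f f≤c = ℕ.⊔-lub (f≤c zero) (maxℕ-lub (f ∘ suc) (f≤c ∘ suc))

≤-ℓ* : ∀ {n} (I : Instance n) (ℓ : Level I) a b → T (Instance.E I a b) → ℓ b ≤ ℓ* I ℓ a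
≤-ℓ* I ℓ a b e with ≤-maxℕ (λ b → if Instance.E I a b then ℓ b else 0) b
... | ℓb≤ℓ* rewrite Equivalence.to T-≡ e = ℓb≤ℓ*

ℓ*-lub : ∀ {n} (I : Instance n) (ℓ : Level I) a {c} → (∀ b → T (Instance.E I a b) → ℓ b ≤ c) → ℓ* I ℓ a ≤ c
ℓ*-lub I ℓ a {c} nbr≤c = maxℕ-lub _ bound
  where
  bound : ∀ b → (if Instance.E I a b then ℓ b else 0) ≤ c
  bound b with Instance.E I a b in e
  ... | true  = nbr≤c b (Equivalence.from T-≡ e)
  ... | false = z≤n

i≤0⇒-+∣i∣≡i : ∀ {i} → i ℤ.≤ 0ℤ → ℤ.- (ℤ.+ ∣ i ∣) ≡ i
i≤0⇒-+∣i∣≡i {ℤ.+ zero}   _          = refl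
i≤0⇒-+∣i∣≡i {ℤ.+ suc k}  (ℤ.+≤+ ())
i≤0⇒-+∣i∣≡i {ℤ.-[1+ k ]} _          = refl

-1+i≤j⇒i≤1+j : ∀ {i j} → ℤ.-1ℤ ℤ.+ ℤ.+ i ℤ.≤ ℤ.+ j → i ≤ suc j
-1+i≤j⇒i≤1+j {zero}  _ = z≤n
-1+i≤j⇒i≤1+j {suc i} h = s≤s (ℤ.drop‿+≤+ h)

injective⇒surjective : ∀ {m} {f : Fin m → Fin m} → Injective _≡_ _≡_ f → ∀ b → ∃ λ a → f a ≡ b
injective⇒surjective {suc m} {f} f-inj b with any? (λ a → f a ≟ b)
... | yes hit  = hit
... | no  miss = contradiction (injective⇒≤ punched-inj) ℕ.1+n≰n
  where
  b≢f : ∀ a → ¬ b ≡ f a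
  b≢f a b≡fa = miss (a , sym b≡fa)
  punched : Fin (suc m) → Fin m
  punched a = punchOut (b≢f a)
  punched-inj : Injective _≡_ _≡_ punched
  punched-inj {a} {a'} = f-inj ∘ punchOut-injective (b≢f a) (b≢f a')

matching-permutation : ∀ {m} (I : Instance m) → PerfectMatching I → Permutation m m
matching-permutation I M = permutation mate (proj₁ ∘ surj) (proj₂ ∘ surj) (λ a → inj (proj₂ (surj (mate a))))
  where
  open PerfectMatching M
  surj : ∀ b → ∃ λ a → mate a ≡ b
  surj = injective⇒surjective inj

module _ {n : ℕ} (I : Instance n) {ℓ : Level I} (π : Permutation n n) (S : Fin n → Bool)
         (covered : ∀ a → T (S (π ⟨$⟩ʳ a)) → Eℓ I ℓ a (π ⟨$⟩ʳ a))
         (closed  : ∀ a → T (S (π ⟨$⟩ʳ a)) → ∀ b → Eℓ I ℓ a b → T (S b))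
         (M : Matching I ℓ) where

  private
    σ : Fin n → Fin n
    σ = π ⟨$⟩ʳ_

    σ-injective : Injective _≡_ _≡_ σ
    σ-injective = Injection.injective (Inverse⇒Injection π)

    mt : Fin n → Maybe (Fin n)
    mt = Matching.mate M

    inS outS : Maybe (Fin n) → Bool
    inS  = maybe′ S false
    outS = maybe′ (not ∘ S) false

    dropS : Maybe (Fin n) → Maybe (Fin n)
    dropS nothing  = nothing
    dropS (just c) = if S c then nothing else just c

    -- Re-match π⁻¹(S) along π and keep the edges of M into the complement of S. As S is closed, no
    -- agent of π⁻¹(S) had such an edge, so nothing is lost, while every item of S becomes matched.
    exchanged : Fin n → Maybe (Fin n)
    exchanged a = if S (σ a) then just (σ a) else dropS (mt a)

    exchanged-just : ∀ a c → exchanged a ≡ just c →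
                     (T (S (σ a)) × σ a ≡ c) ⊎ (mt a ≡ just c × ¬ T (S c))
    exchanged-just a c eq with S (σ a) | mt a
    ... | true  | _ = inj₁ (_ , just-injective eq)
    exchanged-just a c () | false | nothing
    exchanged-just a c eq | false | just d with S d in Sd≡false
    exchanged-just a c () | false | just d | true
    exchanged-just a d refl | false | just d | false = inj₂ (refl , subst T Sd≡false)

    exchanged-injective : PartialInjective exchanged
    exchanged-injective a a' c p q with exchanged-just a c p | exchanged-just a' c q
    ... | inj₁ (_ , σa≡c)     | inj₁ (_ , σa'≡c)     = σ-injective (trans σa≡c (sym σa'≡c))
    ... | inj₁ (Sσa , σa≡c)   | inj₂ (_ , c∉S)       = ⊥-elim (c∉S (subst (T ∘ S) σa≡c Sσa))
    ... | inj₂ (_ , c∉S)      | inj₁ (Sσa' , σa'≡c)  = ⊥-elim (c∉S (subst (T ∘ S) σa'≡c Sσa'))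
    ... | inj₂ (mta≡c , _)    | inj₂ (mta'≡c , _)    = Matching.inj M a a' c mta≡c mta'≡c

    exchanged-inEdges : ∀ a c → exchanged a ≡ just c → Eℓ I ℓ a c
    exchanged-inEdges a c eq with exchanged-just a c eq
    ... | inj₁ (Sσa , refl) = covered a Sσa
    ... | inj₂ (mta≡c , _)  = Matching.inEdges M a c mta≡c

    M′ : Matching I ℓ
    M′ = record { mate = exchanged ; inj = exchanged-injective ; inEdges = exchanged-inEdges }

    size-M : size I M ≡ count (inS ∘ mt) + count (outS ∘ mt)
    size-M = count-split split
      where
      split : ∀ a → 𝟙 (is-just (mt a)) ≡ 𝟙 (inS (mt a)) + 𝟙 (outS (mt a))
      split a with mt a
      ... | nothing = refl
      ... | just c with S c
      ...   | true  = refl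
      ...   | false = refl

    size-M′ : size I M′ ≡ count (S ∘ σ) + count (outS ∘ mt)
    size-M′ = count-split split
      where
      split : ∀ a → 𝟙 (is-just (exchanged a)) ≡ 𝟙 (S (σ a)) + 𝟙 (outS (mt a))
      split a with S (σ a) in Sσa | mt a in mta
      ... | true  | nothing = refl
      ... | true  | just c
        rewrite Equivalence.to T-≡ (closed a (Equivalence.from T-≡ Sσa) c (Matching.inEdges M a c mta)) = refl
      ... | false | nothing = refl
      ... | false | just c with S c
      ...   | true  = refl
      ...   | false = refl

  maximum-matching-covers : IsMaximum I M → ∀ b → T (S b) → ¬ UnmatchedB I M b
  maximum-matching-covers maximum b Sb b-unmatched = ℕ.<-irrefl refl (ℕ.<-≤-trans M<M′ (maximum M′))
    where
    open ℕ.≤-Reasoning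
    avoids-b : ∀ a → inS (mt a) ≡ maybe′ (S ─ b) false (mt a)
    avoids-b a with mt a in mta
    ... | nothing = refl
    ... | just c  = sym (─-≢ S (λ { refl → b-unmatched (a , mta) }))
    M<M′ : size I M < size I M′
    M<M′ = begin-strict
      size I M                                   ≡⟨ size-M ⟩
      count (inS ∘ mt) + count (outS ∘ mt)       ≡⟨ cong (_+ count (outS ∘ mt)) (count-cong avoids-b) ⟩
      count (maybe′ (S ─ b) false ∘ mt) + count (outS ∘ mt)
                                                 ≤⟨ ℕ.+-monoˡ-≤ _ (count-preimage-≤ mt (S ─ b) (Matching.inj M)) ⟩
      count (S ─ b) + count (outS ∘ mt)          <⟨ ℕ.+-monoˡ-< (count (outS ∘ mt)) (ℕ.n<1+n (count (S ─ b))) ⟩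
      suc (count (S ─ b)) + count (outS ∘ mt)    ≡⟨ cong (_+ count (outS ∘ mt)) (count-remove S b Sb) ⟨
      count S + count (outS ∘ mt)                ≡⟨ cong (_+ count (outS ∘ mt)) (count-permute S π) ⟩
      count (S ∘ σ) + count (outS ∘ mt)          ≡⟨ size-M′ ⟨
      size I M′                                  ∎

module DualCertificateProperties {n : ℕ} {I : Instance n} {M : PerfectMatching I} {αA αB : Fin n → ℤ}
                                 (certificate : DualCertificate I M αA αB) where
  open Instance I using (E; pref; irrefl)
  open PerfectMatching M
  open DualCertificate certificate

  feasibleℤ : ∀ a b → T (E a b) → wt I M a b ℤ.≤ αA a ℤ.+ αB b
  feasibleℤ a b e = toℚ-+-cancel-≤ (wt I M a b) (αA a) (αB b) (feasible a b e)

  wt-mate : ∀ a → wt I M a (mate a) ≡ 0ℤ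
  wt-mate a rewrite irrefl a (mate a) = refl

  complementary-slackness : ∀ a → αA a ℤ.+ αB (mate a) ≡ 0ℤ
  complementary-slackness = nonneg-sumℤ≡0⇒≡0 (λ a → αA a ℤ.+ αB (mate a)) mate-edge≥0 (begin
    sumℤ (λ a → αA a ℤ.+ αB (mate a))   ≡⟨ sumℤ-distrib-+ αA (αB ∘ mate) ⟩
    sumℤ αA ℤ.+ sumℤ (αB ∘ mate)         ≡⟨ cong (λ s → sumℤ αA ℤ.+ s) (sumℤ-permute αB (matching-permutation I M)) ⟨
    sumℤ αA ℤ.+ sumℤ αB                  ≡⟨ sumZero ⟩
    0ℤ                                   ∎)
    where
    open ≡-Reasoning
    mate-edge≥0 : ∀ a → 0ℤ ℤ.≤ αA a ℤ.+ αB (mate a)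
    mate-edge≥0 a = subst (ℤ._≤ _) (wt-mate a) (feasibleℤ a (mate a) (inEdges a))

  depth : Fin n → ℕ
  depth b = ∣ αB b ∣

  αB≡-depth : ∀ b → αB b ≡ ℤ.- (ℤ.+ depth b)
  αB≡-depth b = sym (i≤0⇒-+∣i∣≡i (proj₂ (rangeB b)))

  αA≡depth∘mate : ∀ a → αA a ≡ ℤ.+ depth (mate a)
  αA≡depth∘mate a = ℤ.i-j≡0⇒i≡j (αA a) (ℤ.+ depth (mate a))
    (subst (λ z → αA a ℤ.+ z ≡ 0ℤ) (αB≡-depth (mate a)) (complementary-slackness a))

  edge-slack : ∀ a b → T (E a b) → wt I M a b ℤ.+ ℤ.+ depth b ℤ.≤ ℤ.+ depth (mate a)
  edge-slack a b e = begin
    wt I M a b ℤ.+ ℤ.+ depth b                            ≤⟨ ℤ.+-monoˡ-≤ (ℤ.+ depth b) (feasibleℤ a b e) ⟩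
    (αA a ℤ.+ αB b) ℤ.+ ℤ.+ depth b
      ≡⟨ cong₂ (λ x y → (x ℤ.+ y) ℤ.+ ℤ.+ depth b) (αA≡depth∘mate a) (αB≡-depth b) ⟩
    (ℤ.+ depth (mate a) ℤ.- ℤ.+ depth b) ℤ.+ ℤ.+ depth b  ≡⟨ ℤGroup.//-rightDividesˡ (ℤ.+ depth b) (ℤ.+ depth (mate a)) ⟩
    ℤ.+ depth (mate a)                                    ∎
    where open ℤ.≤-Reasoning

  depth-better : ∀ a b → T (E a b) → T (pref a b (mate a)) → suc (depth b) ≤ depth (mate a)
  depth-better a b e b≻mate with pref a b (mate a) | edge-slack a b e
  ... | true | slack = ℤ.drop‿+≤+ slack

  depth-not-worse : ∀ a b → T (E a b) → ¬ T (pref a (mate a) b) → depth b ≤ depth (mate a)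
  depth-not-worse a b e mate⊁b with pref a b (mate a) in b≻mate | pref a (mate a) b | edge-slack a b e
  ... | true  | _     | _     = ℕ.<⇒≤ (depth-better a b e (Equivalence.from T-≡ b≻mate))
  ... | false | true  | _     = ⊥-elim (mate⊁b _)
  ... | false | false | slack = ℤ.drop‿+≤+ slack

  depth-any : ∀ a b → T (E a b) → depth b ≤ suc (depth (mate a))
  depth-any a b e with pref a b (mate a) in b≻mate | pref a (mate a) b | edge-slack a b e
  ... | true  | _     | _     = ℕ.m≤n⇒m≤1+n (ℕ.<⇒≤ (depth-better a b e (Equivalence.from T-≡ b≻mate)))
  ... | false | true  | slack = -1+i≤j⇒i≤1+j slack
  ... | false | false | slack = ℕ.m≤n⇒m≤1+n (ℤ.drop‿+≤+ slack)

  module _ (ℓ : Level I) (ℓ≤depth : ∀ b → ℓ b ≤ depth b) where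
    open ℕ.≤-Reasoning

    Tight : Fin n → Set
    Tight b = ℓ b ≡ depth b

    better-than-mate⇒lower : ∀ a b → Tight (mate a) → T (E a b) → T (pref a b (mate a)) → ℓ b < ℓ (mate a)
    better-than-mate⇒lower a b tight e b≻mate =
      subst (ℓ b <_) (sym tight) (ℕ.≤-trans (s≤s (ℓ≤depth b)) (depth-better a b e b≻mate))

    not-worse-than-mate⇒not-higher : ∀ a b → Tight (mate a) → T (E a b) → ¬ T (pref a (mate a) b) → ℓ b ≤ ℓ (mate a)
    not-worse-than-mate⇒not-higher a b tight e mate⊁b =
      subst (ℓ b ≤_) (sym tight) (ℕ.≤-trans (ℓ≤depth b) (depth-not-worse a b e mate⊁b))

    no-better-at-mate-level : ∀ a → Tight (mate a) → ∀ b → T (E a b) → ℓ b ≡ ℓ (mate a) → ¬ T (pref a b (mate a))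
    no-better-at-mate-level a tight b e ℓb≡ℓmate b≻mate =
      ℕ.<-irrefl ℓb≡ℓmate (better-than-mate⇒lower a b tight e b≻mate)

    ℓ*-of-tight-mate : ∀ a → Tight (mate a) → ℓ* I ℓ a ≡ ℓ (mate a) ⊎ ℓ* I ℓ a ≡ suc (ℓ (mate a))
    ℓ*-of-tight-mate a tight with ℕ.m≤n⇒m<n∨m≡n (ℓ*-lub I ℓ a nbr≤1+mate)
      where
      nbr≤1+mate : ∀ b → T (E a b) → ℓ b ≤ suc (ℓ (mate a))
      nbr≤1+mate b e = subst (λ d → ℓ b ≤ suc d) (sym tight) (ℕ.≤-trans (ℓ≤depth b) (depth-any a b e))
    ... | inj₁ ℓ*≤mate   = inj₁ (ℕ.≤-antisym (s≤s⁻¹ ℓ*≤mate) (≤-ℓ* I ℓ a (mate a) (inEdges a)))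
    ... | inj₂ ℓ*≡1+mate = inj₂ ℓ*≡1+mate

    mate-edge-in-Gℓ : ∀ a → Tight (mate a) → Eℓ I ℓ a (mate a)
    mate-edge-in-Gℓ a tight with ℓ*-of-tight-mate a tight
    ... | inj₁ ℓ*≡mate = inEdges a , inj₁ (sym ℓ*≡mate , λ (b , e , ℓb≡ℓ* , b≻mate) →
            no-better-at-mate-level a tight b e (trans ℓb≡ℓ* ℓ*≡mate) b≻mate)
    ... | inj₂ ℓ*≡1+mate = inEdges a , inj₂ (sym ℓ*≡1+mate , all-worse , λ (b , e , 1+ℓb≡ℓ* , b≻mate) →
            no-better-at-mate-level a tight b e (ℕ.suc-injective (trans 1+ℓb≡ℓ* ℓ*≡1+mate)) b≻mate)
      where
      all-worse : ∀ b → T (E a b) → ℓ b ≡ ℓ* I ℓ a → T (pref a (mate a) b)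
      all-worse b e ℓb≡ℓ* with pref a (mate a) b in mate≻b
      ... | true  = _
      ... | false = ℕ.1+n≰n (subst (_≤ ℓ (mate a)) (trans ℓb≡ℓ* ℓ*≡1+mate)
                      (not-worse-than-mate⇒not-higher a b tight e (subst T mate≻b)))

    Gℓ-neighbour-depth≤ℓ : ∀ a b → Tight (mate a) → Eℓ I ℓ a b → depth b ≤ ℓ b
    Gℓ-neighbour-depth≤ℓ a b tight (e , kind) with ℓ*-of-tight-mate a tight | kind
    ... | inj₁ ℓ*≡mate | inj₁ (ℓb≡ℓ* , none-better) = begin
      depth b          ≤⟨ depth-not-worse a b e (λ mate≻b → none-better (mate a , inEdges a , sym ℓ*≡mate , mate≻b)) ⟩
      depth (mate a)   ≡⟨ tight ⟨
      ℓ (mate a)       ≡⟨ trans ℓb≡ℓ* ℓ*≡mate ⟨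
      ℓ b              ∎
    ... | inj₂ ℓ*≡1+mate | inj₁ (ℓb≡ℓ* , _) = begin
      depth b                ≤⟨ depth-any a b e ⟩
      suc (depth (mate a))   ≡⟨ cong suc tight ⟨
      suc (ℓ (mate a))       ≡⟨ trans ℓb≡ℓ* ℓ*≡1+mate ⟨
      ℓ b                    ∎
    ... | inj₁ ℓ*≡mate | inj₂ (1+ℓb≡ℓ* , all-worse , _) = s≤s⁻¹ (begin
      suc (depth b)    ≤⟨ depth-better a b e (all-worse (mate a) (inEdges a) (sym ℓ*≡mate)) ⟩
      depth (mate a)   ≡⟨ tight ⟨
      ℓ (mate a)       ≡⟨ trans 1+ℓb≡ℓ* ℓ*≡mate ⟨
      suc (ℓ b)        ∎)
    ... | inj₂ ℓ*≡1+mate | inj₂ (1+ℓb≡ℓ* , _ , none-better) = begin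
      depth b          ≤⟨ depth-not-worse a b e (λ mate≻b → none-better (mate a , inEdges a , sym ℓ*≡1+mate , mate≻b)) ⟩
      depth (mate a)   ≡⟨ tight ⟨
      ℓ (mate a)       ≡⟨ ℕ.suc-injective (trans 1+ℓb≡ℓ* ℓ*≡1+mate) ⟨
      ℓ b              ∎

    Gℓ-neighbour-tight : ∀ a b → Tight (mate a) → Eℓ I ℓ a b → Tight b
    Gℓ-neighbour-tight a b tight ab∈Gℓ = ℕ.≤-antisym (ℓ≤depth b) (Gℓ-neighbour-depth≤ℓ a b tight ab∈Gℓ)

    maximum-matching-covers-tight : (Mℓ : Matching I ℓ) → IsMaximum I Mℓ → ∀ b → Tight b → ¬ UnmatchedB I Mℓ b
    maximum-matching-covers-tight Mℓ maximum b tight =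
      maximum-matching-covers I (matching-permutation I M) tight?
        (λ a → mate-edge-in-Gℓ a ∘ ℕ.≡ᵇ⇒≡ _ _)
        (λ a t b' → ℕ.≡⇒≡ᵇ _ _ ∘ Gℓ-neighbour-tight a b' (ℕ.≡ᵇ⇒≡ _ _ t))
        Mℓ maximum b (ℕ.≡⇒≡ᵇ _ _ tight)
      where
      tight? : Fin n → Bool
      tight? b = ℓ b ≡ᵇ depth b

    next-level≤depth : ∀ {ℓ′} (Mℓ : Matching I ℓ) → IsMaximum I Mℓ → NextLevel I Mℓ ℓ′ → ∀ b → ℓ′ b ≤ depth b
    next-level≤depth Mℓ maximum next b with any? (λ a → ≡-dec _≟_ (Matching.mate Mℓ a) (just b))
    ... | yes matched  = subst (_≤ depth b) (sym (proj₂ (next b) (λ unmatched → unmatched matched))) (ℓ≤depth b)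
    ... | no unmatched = subst (_≤ depth b) (sym (proj₁ (next b) unmatched))
                           (ℕ.≤∧≢⇒< (ℓ≤depth b) (λ tight → maximum-matching-covers-tight Mℓ maximum b tight unmatched))

  level≤depth : ∀ {ℓ} → Reachable I ℓ → ∀ b → ℓ b ≤ depth b
  level≤depth start                                 _ = z≤n
  level≤depth (step {ℓ} reachable _ Mℓ maximum _ next) = next-level≤depth ℓ (level≤depth reachable) Mℓ maximum next

-- Popularity of M matters only through the existence of the certificate, and the bound holds at
-- every iteration of the algorithm, not just the last one.
theorem9 : ∀ (n : ℕ) (I : Instance n) (M : PerfectMatching I) → Popular I M →
           ∀ (αA αB : Fin n → ℤ) → DualCertificate I M αA αB →
           ∀ (ℓ : Level I) → Reachable I ℓ → Terminal I ℓ →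
           ∀ (b : Fin n) → ℓ b ≤ ∣ αB b ∣
theorem9 n I M _ αA αB certificate ℓ reachable _ = level≤depth reachable
  where open DualCertificateProperties certificate
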